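{- Let $a,b\ge 2$ be integers such that $\mathrm{b}'(a,b)$ is defined. Then $\mathrm{b}'(a,b)\ge\lceil\log_b(a+1)\rceil+1$.
   Context: $\mathrm{b}'(a,b)$ denotes the base size (smallest cardinality of a subset whose pointwise stabilizer is trivial) of $\mathrm{Alt}(ab)$ acting on the set of partitions of $\{1,\ldots,ab\}$ into $b$ parts each of cardinality $a$; it is defined whenever this action is faithful. -}

module Defs where

open import Data.Nat using (ℕ; zero; suc; _+_; _*_; _^_; _≤?_)
open import Data.Fin using (Fin; _<?_; _≟_)
open import Data.Fin.Permutation using (Permutation′; _⟨$⟩ʳ_)
open import Data.List using (List; length; filter; allFin; map)
open import Data.Nat.ListAction using (sum)
open import Data.Product using (_×_)
open import Data.Nat.Properties using ()
open import Relation.Nullary using (yes; no; _×-dec_)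
open import Relation.Binary.PropositionalEquality using (_≡_)
open import Function.Bundles using (_⇔_)

inversions : ∀ {n} → Permutation′ n → ℕ
inversions {n} π =
  sum (map (λ i → length (filter (λ j → (i <? j) ×-dec ((π ⟨$⟩ʳ j) <? (π ⟨$⟩ʳ i))) (allFin n)))
           (allFin n))

data Even : ℕ → Set where
  even-zero : Even zero
  even-ss   : ∀ {m} → Even m → Even (suc (suc m))

IsEvenPerm : ∀ {n} → Permutation′ n → Set
IsEvenPerm π = Even (inversions π)

-- Two labellings
-- describe the same (unordered) partition iff they induce the same
-- equivalence relation; the group action is phrased accordingly.
record Partition (n a b : ℕ) : Set where
  field
    block : Fin n → Fin b
    sizes : ∀ (j : Fin b) → length (filter (λ x → block x ≟ j) (allFin n)) ≡ a
open Partition public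

Fixes : ∀ {n a b} → Permutation′ n → Partition n a b → Set
Fixes g P = ∀ x y → (block P (g ⟨$⟩ʳ x) ≡ block P (g ⟨$⟩ʳ y)) ⇔ (block P x ≡ block P y)

IsIdentity : ∀ {n} → Permutation′ n → Set
IsIdentity g = ∀ x → g ⟨$⟩ʳ x ≡ x

-- Alt(ab) acts faithfully on the partitions into b parts of size a
-- (this is exactly when b'(a,b) is defined).
Faithful : ℕ → ℕ → Set
Faithful a b = ∀ (g : Permutation′ (a * b)) → IsEvenPerm g →
  (∀ (P : Partition (a * b) a b) → Fixes g P) → IsIdentity g

IsBase : ∀ (a b k : ℕ) → (Fin k → Partition (a * b) a b) → Set
IsBase a b k Ps = ∀ (g : Permutation′ (a * b)) → IsEvenPerm g →
  (∀ i → Fixes g (Ps i)) → IsIdentity g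

ceilLogFrom : ℕ → ℕ → ℕ → ℕ → ℕ
ceilLogFrom b x m zero = m
ceilLogFrom b x m (suc fuel) with x ≤? b ^ m
... | yes _ = m
... | no  _ = ceilLogFrom b x (suc m) fuel

-- For b ≥ 2 we have x ≤ b ^ x, so fuel x suffices.
ceilLog : ℕ → ℕ → ℕ
ceilLog b x = ceilLogFrom b x 0 x

-- A family of k partitions gives every point a signature in (Fin b)^k, its
-- blocks in the k partitions.  Points with equal signatures are swapped by a
-- transposition fixing every partition, so two different colliding pairs yield
-- an even permutation (a product of two transpositions) in the pointwise
-- stabiliser: a base has at most one collision.  Now suppose the bound fails,
-- i.e. b^(k-1) <= a.  If the signature is injective, counting makes it a
-- bijection onto a grid whose rows are the blocks of the first partition and
-- whose columns are the signatures in the others; permuting two or three rows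
-- in every column is then a nontrivial even permutation fixing all partitions.
-- If there is one collision, every block avoiding it embeds through the
-- remaining coordinates into (Fin b)^(k-1), so a <= b^(k-1), and the embedding
-- is onto.  Hence the signature is onto (Fin b)^k while identifying two points,
-- so b * b^(k-1) < ab, a contradiction.  Evenness is the parity of the
-- inversion number, which every transposition flips.
module Submission where

open import Defs
open import Data.Nat as ℕ using (ℕ; zero; suc; 2+; _+_; _*_; _^_; _≤_; _<_; z≤n; s≤s; parity)
import Data.Nat.Properties as ℕₚ
open import Data.Nat.ListAction using (sum)
open import Data.Nat.Tactic.RingSolver using (solve-∀)
open import Data.Parity.Base using (0ℙ; 1ℙ; _⁻¹) renaming (_+_ to _⊕_)
import Data.Parity.Properties as Parityₚ
open import Data.Fin as Fin using (Fin; zero; suc; toℕ; funToFin; finToFun; punchIn; punchOut)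
open import Data.Fin.Permutation as Permutation using (Permutation′; _⟨$⟩ʳ_; _⟨$⟩ˡ_; _∘ₚ_; id; transpose)
import Data.Fin.Permutation.Components as PC
open import Data.Fin.Permutation.Transposition.List using (TranspositionList; eval)
import Data.Fin.Properties as Finₚ
open import Data.List using (List; []; _∷_; _++_; [_]; length; filter; tabulate; allFin; map; lookup)
open import Data.List.Membership.Propositional.Properties using (∈-lookup; ∈-filter⁻)
open import Data.List.Relation.Unary.Unique.Propositional using (Unique)
open import Data.List.Relation.Unary.AllPairs using (_∷_)
import Data.List.Relation.Unary.Unique.Propositional.Properties as Uniqueₚ
import Data.List.Properties as Listₚ
open import Data.List.Relation.Unary.All as All using (All; []; _∷_)
import Data.List.Relation.Unary.All.Properties as Allₚ
open import Data.Product using (∃; ∃₂; _×_; _,_; proj₁; proj₂; map₂)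
open import Data.Bool using (true; false)
open import Data.Empty using (⊥; ⊥-elim)
open import Data.Sum using (_⊎_; inj₁; inj₂)
open import Function using (_∘_; mk⇔)
open import Function.Definitions using (Injective)
open import Level using (0ℓ)
open import Relation.Nullary using (Dec; yes; no; does; ¬_; ¬?; _×-dec_)
open import Relation.Nullary.Decidable using (dec-true; dec-false)
open import Relation.Unary using (Pred; Decidable)
open import Relation.Binary.Definitions using (tri<; tri≈; tri>)
open import Relation.Binary.PropositionalEquality hiding ([_])

-- The sign of a permutation

parity≡0ℙ⇒Even : ∀ n → parity n ≡ 0ℙ → Even n
parity≡0ℙ⇒Even zero          _ = even-zero
parity≡0ℙ⇒Even (suc (suc n)) p = even-ss (parity≡0ℙ⇒Even n p)

parity-double : ∀ n → parity (n + n) ≡ 0ℙ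
parity-double n = trans (Parityₚ.+-homo-+ n n) (Parityₚ.p+p≡0ℙ (parity n))

parity-suc : ∀ n → parity (suc n) ≡ parity n ⁻¹
parity-suc n = sym (Parityₚ.⁻¹-selfInverse (Parityₚ.suc-homo-⁻¹ n))

⊕-⁻¹ʳ : ∀ p q → p ⊕ q ⁻¹ ≡ (p ⊕ q) ⁻¹
⊕-⁻¹ʳ 0ℙ q = refl
⊕-⁻¹ʳ 1ℙ q = refl

⊕≡1ℙ : ∀ p q → p ⊕ q ≡ 1ℙ → q ≡ p ⁻¹
⊕≡1ℙ 0ℙ 1ℙ _ = refl
⊕≡1ℙ 1ℙ 0ℙ _ = refl

parity-odd-sum : ∀ m n k → m + n ≡ suc (k + k) → parity n ≡ parity m ⁻¹
parity-odd-sum m n k eq = ⊕≡1ℙ (parity m) (parity n) (begin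
  parity m ⊕ parity n  ≡⟨ Parityₚ.+-homo-+ m n ⟨
  parity (m + n)       ≡⟨ cong parity eq ⟩
  parity (suc (k + k)) ≡⟨ parity-suc (k + k) ⟩
  parity (k + k) ⁻¹    ≡⟨ cong _⁻¹ (parity-double k) ⟩
  1ℙ                   ∎)
  where open ≡-Reasoning

length-filter-++ : ∀ {A : Set} {P : Pred A 0ℓ} (P? : Decidable P) xs ys →
  length (filter P? (xs ++ ys)) ≡ length (filter P? xs) + length (filter P? ys)
length-filter-++ P? xs ys =
  trans (cong length (Listₚ.filter-++ P? xs ys)) (Listₚ.length-++ (filter P? xs))

length-filter-tabulate : ∀ {n} {A B : Set} {P : Pred A 0ℓ} {Q : Pred B 0ℓ}
  (P? : Decidable P) (Q? : Decidable Q) (f : Fin n → A) (g : Fin n → B) →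
  (∀ i → does (P? (f i)) ≡ does (Q? (g i))) →
  length (filter P? (tabulate f)) ≡ length (filter Q? (tabulate g))
length-filter-tabulate {zero}  P? Q? f g eq = refl
length-filter-tabulate {suc n} P? Q? f g eq
  with does (P? (f zero)) | does (Q? (g zero)) | eq zero
     | length-filter-tabulate P? Q? (f ∘ suc) (g ∘ suc) (eq ∘ suc)
... | true  | true  | _ | ih = cong suc ih
... | false | false | _ | ih = ih

sum-map-tabulate : ∀ {n} {A B : Set} (r : A → ℕ) (s : B → ℕ) (f : Fin n → A) (g : Fin n → B) →
  (∀ i → r (f i) ≡ s (g i)) → sum (map r (tabulate f)) ≡ sum (map s (tabulate g))
sum-map-tabulate {zero}  r s f g eq = refl
sum-map-tabulate {suc n} r s f g eq =
  cong₂ _+_ (eq zero) (sum-map-tabulate r s (f ∘ suc) (g ∘ suc) (eq ∘ suc))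

sum-map-zero : ∀ {A : Set} (r : A → ℕ) → (∀ x → r x ≡ 0) → ∀ xs → sum (map r xs) ≡ 0
sum-map-zero r r≡0 []       = refl
sum-map-zero r r≡0 (x ∷ xs) = cong₂ _+_ (r≡0 x) (sum-map-zero r r≡0 xs)

below : ℕ → List ℕ → ℕ
below x ys = length (filter (ℕ._<? x) ys)

above : ℕ → List ℕ → ℕ
above x ys = length (filter (x ℕ.<?_) ys)

listInversions : List ℕ → ℕ
listInversions []       = 0
listInversions (x ∷ xs) = below x xs + listInversions xs

crossInversions : List ℕ → List ℕ → ℕ
crossInversions []       ys = 0
crossInversions (x ∷ xs) ys = below x ys + crossInversions xs ys

below-++ : ∀ x xs ys → below x (xs ++ ys) ≡ below x xs + below x ys
below-++ x = length-filter-++ (ℕ._<? x)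

below+above≡length : ∀ x ys → All (_≢ x) ys → below x ys + above x ys ≡ length ys
below+above≡length x []       []          = refl
below+above≡length x (y ∷ ys) (y≢x ∷ ys≢x) with ℕₚ.<-cmp y x
... | tri< y<x _ _
  rewrite dec-true (y ℕ.<? x) y<x | dec-false (x ℕ.<? y) (ℕₚ.<⇒≯ y<x)
  = cong suc (below+above≡length x ys ys≢x)
... | tri≈ _ y≡x _ = ⊥-elim (y≢x y≡x)
... | tri> _ _ x<y
  rewrite dec-false (y ℕ.<? x) (ℕₚ.<⇒≯ x<y) | dec-true (x ℕ.<? y) x<y
  = trans (ℕₚ.+-suc (below x ys) (above x ys)) (cong suc (below+above≡length x ys ys≢x))

below-[]≡above-[] : ∀ x y → below x [ y ] ≡ above y [ x ]
below-[]≡above-[] x y with does (y ℕ.<? x)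
... | true  = refl
... | false = refl

crossInversions-∷ʳ : ∀ xs y ys → crossInversions xs (y ∷ ys) ≡ above y xs + crossInversions xs ys
crossInversions-∷ʳ []       y ys = refl
crossInversions-∷ʳ (x ∷ xs) y ys = begin
  below x (y ∷ ys) + crossInversions xs (y ∷ ys)
    ≡⟨ cong₂ _+_ (below-++ x [ y ] ys) (crossInversions-∷ʳ xs y ys) ⟩
  below x [ y ] + below x ys + (above y xs + crossInversions xs ys)
    ≡⟨ interchange (below x [ y ]) (below x ys) (above y xs) (crossInversions xs ys) ⟩
  below x [ y ] + above y xs + (below x ys + crossInversions xs ys)
    ≡⟨ cong (λ c → c + above y xs + (below x ys + crossInversions xs ys)) (below-[]≡above-[] x y) ⟩
  above y [ x ] + above y xs + (below x ys + crossInversions xs ys)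
    ≡⟨ cong (_+ (below x ys + crossInversions xs ys)) (length-filter-++ (y ℕ.<?_) [ x ] xs) ⟨
  above y (x ∷ xs) + crossInversions (x ∷ xs) ys ∎
  where
  open ≡-Reasoning
  interchange : ∀ a b c d → a + b + (c + d) ≡ a + c + (b + d)
  interchange = solve-∀

listInversions-++ : ∀ xs ys →
  listInversions (xs ++ ys) ≡ listInversions xs + crossInversions xs ys + listInversions ys
listInversions-++ []       ys = refl
listInversions-++ (x ∷ xs) ys rewrite below-++ x xs ys | listInversions-++ xs ys =
  regroup (below x xs) (below x ys) (listInversions xs) (crossInversions xs ys) (listInversions ys)
  where
  regroup : ∀ a b c d e → a + b + (c + d + e) ≡ a + c + (b + d) + e
  regroup = solve-∀

listInversions-∷-++-∷ : ∀ x y M S →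
  listInversions (x ∷ M ++ y ∷ S) ≡
    below x M + above y M + below x [ y ] +
      (below x S + below y S + (listInversions M + crossInversions M S + listInversions S))
listInversions-∷-++-∷ x y M S = begin
  below x (M ++ y ∷ S) + listInversions (M ++ y ∷ S)
    ≡⟨ cong₂ _+_ (trans (below-++ x M (y ∷ S)) (cong (below x M +_) (below-++ x [ y ] S)))
                 (trans (listInversions-++ M (y ∷ S))
                        (cong (λ c → listInversions M + c + listInversions (y ∷ S)) (crossInversions-∷ʳ M y S))) ⟩
  below x M + (below x [ y ] + below x S) +
    (listInversions M + (above y M + crossInversions M S) + (below y S + listInversions S))
    ≡⟨ regroup (below x M) (below x [ y ]) (below x S) (listInversions M) (above y M)
               (crossInversions M S) (below y S) (listInversions S) ⟩
  below x M + above y M + below x [ y ] +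
    (below x S + below y S + (listInversions M + crossInversions M S + listInversions S)) ∎
  where
  open ≡-Reasoning
  regroup : ∀ a b c d e f g h → a + (b + c) + (d + (e + f) + (g + h)) ≡ a + e + b + (c + g + (d + f + h))
  regroup = solve-∀

-- Each of x and y precedes M in one list and follows it in the other, so its
-- comparisons with M contribute |M| to the sum; x and y are compared once, and
-- every other pair is counted twice.
listInversions-swap-ends : ∀ x y M S → x ≢ y → All (λ z → z ≢ x × z ≢ y) M →
  parity (listInversions (y ∷ M ++ x ∷ S)) ≡ parity (listInversions (x ∷ M ++ y ∷ S)) ⁻¹
listInversions-swap-ends x y M S x≢y M∌xy =
  parity-odd-sum (listInversions (x ∷ M ++ y ∷ S)) (listInversions (y ∷ M ++ x ∷ S)) (length M + D) (begin
  listInversions (x ∷ M ++ y ∷ S) + listInversions (y ∷ M ++ x ∷ S)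
    ≡⟨ cong₂ _+_ (listInversions-∷-++-∷ x y M S) (listInversions-∷-++-∷ y x M S) ⟩
  below x M + above y M + below x [ y ] + D + (below y M + above x M + below y [ x ] + D′)
    ≡⟨ cong₂ (λ s t → below x M + above y M + below x [ y ] + D + (below y M + above x M + s + t))
             (below-[]≡above-[] y x) (cong (_+ R) (ℕₚ.+-comm (below y S) (below x S))) ⟩
  below x M + above y M + below x [ y ] + D + (below y M + above x M + above x [ y ] + D)
    ≡⟨ odd-sum (below x M) (above x M) (below y M) (above y M) (below x [ y ]) (above x [ y ]) D
               (below+above≡length x M (All.map proj₁ M∌xy))
               (below+above≡length y M (All.map proj₂ M∌xy))
               (below+above≡length x [ y ] ((x≢y ∘ sym) ∷ [])) ⟩
  suc (length M + D + (length M + D)) ∎)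
  where
  open ≡-Reasoning
  R D D′ : ℕ
  R  = listInversions M + crossInversions M S + listInversions S
  D  = below x S + below y S + R
  D′ = below y S + below x S + R
  regroup : ∀ a b c d e f D → a + d + e + D + (c + b + f + D) ≡ a + b + (c + d) + (e + f) + (D + D)
  regroup = solve-∀
  finish : ∀ m D → m + m + 1 + (D + D) ≡ suc (m + D + (m + D))
  finish = solve-∀
  odd-sum : ∀ a b c d e f D {m} → a + b ≡ m → c + d ≡ m → e + f ≡ 1 →
    a + d + e + D + (c + b + f + D) ≡ suc (m + D + (m + D))
  odd-sum a b c d e f D {m} p q r
    rewrite regroup a b c d e f D | p | q | r = finish m D

below-swap : ∀ p P x y M S → below p (P ++ y ∷ M ++ x ∷ S) ≡ below p (P ++ x ∷ M ++ y ∷ S)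
below-swap p P x y M S = begin
  below p (P ++ y ∷ M ++ x ∷ S)
    ≡⟨ split y x ⟩
  below p P + (below p [ y ] + (below p M + (below p [ x ] + below p S)))
    ≡⟨ cong (below p P +_) (exchange (below p [ y ]) (below p M) (below p [ x ]) (below p S)) ⟩
  below p P + (below p [ x ] + (below p M + (below p [ y ] + below p S)))
    ≡⟨ split x y ⟨
  below p (P ++ x ∷ M ++ y ∷ S) ∎
  where
  open ≡-Reasoning
  split : ∀ u v → below p (P ++ u ∷ M ++ v ∷ S) ≡
    below p P + (below p [ u ] + (below p M + (below p [ v ] + below p S)))
  split u v =
    trans (below-++ p P _) (cong (below p P +_)
      (trans (below-++ p [ u ] _) (cong (below p [ u ] +_)
        (trans (below-++ p M _) (cong (below p M +_) (below-++ p [ v ] S))))))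
  exchange : ∀ a b c d → a + (b + (c + d)) ≡ c + (b + (a + d))
  exchange = solve-∀

listInversions-swap : ∀ P x y M S → x ≢ y → All (λ z → z ≢ x × z ≢ y) M →
  parity (listInversions (P ++ y ∷ M ++ x ∷ S)) ≡ parity (listInversions (P ++ x ∷ M ++ y ∷ S)) ⁻¹
listInversions-swap []      = listInversions-swap-ends
listInversions-swap (p ∷ P) x y M S x≢y M∌xy = begin
  parity (below p L′ + listInversions L′)
    ≡⟨ Parityₚ.+-homo-+ (below p L′) (listInversions L′) ⟩
  parity (below p L′) ⊕ parity (listInversions L′)
    ≡⟨ cong₂ _⊕_ (cong parity (below-swap p P x y M S)) (listInversions-swap P x y M S x≢y M∌xy) ⟩
  parity (below p L) ⊕ parity (listInversions L) ⁻¹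
    ≡⟨ ⊕-⁻¹ʳ (parity (below p L)) (parity (listInversions L)) ⟩
  (parity (below p L) ⊕ parity (listInversions L)) ⁻¹
    ≡⟨ cong _⁻¹ (Parityₚ.+-homo-+ (below p L) (listInversions L)) ⟨
  parity (below p L + listInversions L) ⁻¹ ∎
  where
  open ≡-Reasoning
  L L′ : List ℕ
  L  = P ++ x ∷ M ++ y ∷ S
  L′ = P ++ y ∷ M ++ x ∷ S

⟨$⟩ʳ-injective : ∀ {n} (π : Permutation′ n) {k l} → π ⟨$⟩ʳ k ≡ π ⟨$⟩ʳ l → k ≡ l
⟨$⟩ʳ-injective π {k} {l} eq =
  trans (sym (Permutation.inverseˡ π)) (trans (cong (π ⟨$⟩ˡ_) eq) (Permutation.inverseˡ π))

transpose-matchˡ : ∀ {n} (i j : Fin n) → PC.transpose i j i ≡ j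
transpose-matchˡ i j rewrite dec-true (i Fin.≟ i) refl = refl

transpose-matchʳ : ∀ {n} (i j : Fin n) → PC.transpose i j j ≡ i
transpose-matchʳ i j with i Fin.≟ j
... | yes refl = transpose-matchˡ i i
... | no  i≢j rewrite dec-false (j Fin.≟ i) (i≢j ∘ sym) | dec-true (j Fin.≟ j) refl = refl

transpose-other : ∀ {n} {i j k : Fin n} → k ≢ i → k ≢ j → PC.transpose i j k ≡ k
transpose-other {i = i} {j} {k} k≢i k≢j
  rewrite dec-false (k Fin.≟ i) k≢i | dec-false (k Fin.≟ j) k≢j = refl

transpose-elim : ∀ {n} {i j : Fin n} (Q : Fin n → Set) k →
  (k ≡ i → Q j) → (k ≡ j → Q i) → (k ≢ i → k ≢ j → Q k) → Q (PC.transpose i j k)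
transpose-elim {i = i} {j} Q k at-i at-j elsewhere = by-cases (k Fin.≟ i) (k Fin.≟ j)
  where
  by-cases : Dec (k ≡ i) → Dec (k ≡ j) → Q (PC.transpose i j k)
  by-cases (yes refl) _          = subst Q (sym (transpose-matchˡ k j)) (at-i refl)
  by-cases (no  k≢i)  (yes refl) = subst Q (sym (transpose-matchʳ i k)) (at-j refl)
  by-cases (no  k≢i)  (no  k≢j)  = subst Q (sym (transpose-other k≢i k≢j)) (elsewhere k≢i k≢j)

transpose-comm : ∀ {n} (i j k : Fin n) → PC.transpose i j k ≡ PC.transpose j i k
transpose-comm i j k = transpose-elim (_≡ PC.transpose j i k) k
  (λ { refl → sym (transpose-matchʳ j k) })
  (λ { refl → sym (transpose-matchˡ k i) })
  (λ k≢i k≢j → sym (transpose-other k≢j k≢i))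

transpose-injective : ∀ {n} (i j : Fin n) {k l} → PC.transpose i j k ≡ PC.transpose i j l → k ≡ l
transpose-injective i j {k} {l} eq = begin
  k                                      ≡⟨ PC.transpose-inverse j i ⟨
  PC.transpose j i (PC.transpose i j k)  ≡⟨ cong (PC.transpose j i) eq ⟩
  PC.transpose j i (PC.transpose i j l)  ≡⟨ PC.transpose-inverse j i ⟩
  l                                      ∎
  where open ≡-Reasoning

transpose-suc : ∀ {n} (i j k : Fin n) → PC.transpose (suc i) (suc j) (suc k) ≡ suc (PC.transpose i j k)
transpose-suc i j k = transpose-elim (λ t → PC.transpose (suc i) (suc j) (suc k) ≡ suc t) k
  (λ { refl → transpose-matchˡ (suc k) (suc j) })
  (λ { refl → transpose-matchʳ (suc i) (suc k) })
  (λ k≢i k≢j → transpose-other (k≢i ∘ Finₚ.suc-injective) (k≢j ∘ Finₚ.suc-injective))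

transpose-natural : ∀ {m n} {f : Fin m → Fin n} → Injective _≡_ _≡_ f → ∀ u v t →
  PC.transpose (f u) (f v) (f t) ≡ f (PC.transpose u v t)
transpose-natural {f = f} f-inj u v t = transpose-elim (λ s → PC.transpose (f u) (f v) (f t) ≡ f s) t
  (λ { refl → transpose-matchˡ (f t) (f v) })
  (λ { refl → transpose-matchʳ (f u) (f t) })
  (λ t≢u t≢v → transpose-other (t≢u ∘ f-inj) (t≢v ∘ f-inj))

tabulate-split : ∀ {A : Set} {n} (f g : Fin n → A) (j : Fin n) (Q : A → Set) →
  (∀ k → k ≢ j → f k ≡ g k) → (∀ k → k ≢ j → Q (f k)) →
  ∃₂ λ M S → tabulate f ≡ M ++ f j ∷ S × tabulate g ≡ M ++ g j ∷ S × All Q M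
tabulate-split f g zero Q f≗g Qf =
  [] , tabulate (f ∘ suc) , refl , cong (g zero ∷_) (Listₚ.tabulate-cong (λ k → sym (f≗g (suc k) λ ()))) , []
tabulate-split f g (suc j) Q f≗g Qf
  with tabulate-split (f ∘ suc) (g ∘ suc) j Q (λ k k≢j → f≗g (suc k) (k≢j ∘ Finₚ.suc-injective))
                                              (λ k k≢j → Qf (suc k) (k≢j ∘ Finₚ.suc-injective))
... | M , S , f≡ , g≡ , QM =
  f zero ∷ M , S , cong (f zero ∷_) f≡ , cong₂ _∷_ (sym (f≗g zero λ ())) g≡ , Qf zero (λ ()) ∷ QM

tabulate-transpose : ∀ {A : Set} {n} (f : Fin n → A) {i j : Fin n} → i Fin.< j → (Q : A → Set) →
  (∀ k → k ≢ i → k ≢ j → Q (f k)) →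
  ∃₂ λ P M → ∃ λ S → tabulate f ≡ P ++ f i ∷ M ++ f j ∷ S ×
                     tabulate (f ∘ PC.transpose i j) ≡ P ++ f j ∷ M ++ f i ∷ S × All Q M
tabulate-transpose f {zero} {suc j} _ Q Qf
  with tabulate-split (f ∘ suc) (f ∘ PC.transpose zero (suc j) ∘ suc) j Q
         (λ k k≢j → cong f (sym (transpose-other {i = zero} (λ ()) (k≢j ∘ Finₚ.suc-injective))))
         (λ k k≢j → Qf (suc k) (λ ()) (k≢j ∘ Finₚ.suc-injective))
... | M , S , f≡ , τf≡ , QM =
  [] , M , S , cong (f zero ∷_) f≡ ,
  cong₂ _∷_ (cong f (transpose-matchˡ zero (suc j)))
            (trans τf≡ (cong (λ t → M ++ f t ∷ S) (transpose-matchʳ zero (suc j)))) ,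
  QM
tabulate-transpose f {suc i} {suc j} (s≤s i<j) Q Qf
  with tabulate-transpose (f ∘ suc) i<j Q
         (λ k k≢i k≢j → Qf (suc k) (k≢i ∘ Finₚ.suc-injective) (k≢j ∘ Finₚ.suc-injective))
... | P , M , S , f≡ , τf≡ , QM =
  f zero ∷ P , M , S , cong (f zero ∷_) f≡ ,
  cong₂ _∷_ (cong f (transpose-other {i = suc i} {suc j} (λ ()) (λ ())))
            (trans (Listₚ.tabulate-cong (cong f ∘ transpose-suc i j)) τf≡) ,
  QM

inversionsᶠ : ∀ {n} → (Fin n → ℕ) → ℕ
inversionsᶠ {n} f =
  sum (map (λ i → length (filter (λ j → (i Fin.<? j) ×-dec (f j ℕ.<? f i)) (allFin n))) (allFin n))

inversionsᶠ≡listInversions : ∀ {n} (f : Fin n → ℕ) → inversionsᶠ f ≡ listInversions (tabulate f)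
inversionsᶠ≡listInversions {zero}  f = refl
inversionsᶠ≡listInversions {suc n} f = cong₂ _+_
  (length-filter-tabulate (later zero) (ℕ._<? f zero)
                          suc (f ∘ suc) (λ _ → refl))
  (trans (sum-map-tabulate (λ i → length (filter (later i) (allFin (suc n))))
                           (λ i → length (filter (later′ i) (allFin n)))
                           suc (λ i → i)
                           (λ i → length-filter-tabulate (later (suc i)) (later′ i) suc (λ j → j) (λ _ → refl)))
         (inversionsᶠ≡listInversions (f ∘ suc)))
  where
  later : ∀ (i j : Fin (suc n)) → Dec ((i Fin.< j) × (f j < f i))
  later i j = (i Fin.<? j) ×-dec (f j ℕ.<? f i)
  later′ : ∀ (i j : Fin n) → Dec ((i Fin.< j) × (f (suc j) < f (suc i)))
  later′ i j = (i Fin.<? j) ×-dec (f (suc j) ℕ.<? f (suc i))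

values : ∀ {n} → Permutation′ n → List ℕ
values π = tabulate (toℕ ∘ (π ⟨$⟩ʳ_))

-- `inversions π` unfolds to `inversionsᶠ (toℕ ∘ (π ⟨$⟩ʳ_))`, since `_<?_` on `Fin`
-- compares `toℕ` values.
inversions≡listInversions : ∀ {n} (π : Permutation′ n) → inversions π ≡ listInversions (values π)
inversions≡listInversions π = inversionsᶠ≡listInversions (toℕ ∘ (π ⟨$⟩ʳ_))

inversions-cong : ∀ {n} {π ρ : Permutation′ n} → (∀ k → π ⟨$⟩ʳ k ≡ ρ ⟨$⟩ʳ k) →
  inversions π ≡ inversions ρ
inversions-cong {π = π} {ρ} π≗ρ = begin
  inversions π                  ≡⟨ inversions≡listInversions π ⟩
  listInversions (values π)     ≡⟨ cong listInversions (Listₚ.tabulate-cong (cong toℕ ∘ π≗ρ)) ⟩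
  listInversions (values ρ)     ≡⟨ inversions≡listInversions ρ ⟨
  inversions ρ                  ∎
  where open ≡-Reasoning

inversions-id : ∀ {n} → inversions (id {n}) ≡ 0
inversions-id {n} = sum-map-zero _
  (λ i → cong length (Listₚ.filter-none (λ j → (i Fin.<? j) ×-dec (j Fin.<? i))
                                        (All.universal (no-pair i) (allFin n))))
  (allFin n)
  where
  no-pair : ∀ (i j : Fin n) → ¬ ((i Fin.< j) × (j Fin.< i))
  no-pair i j (i<j , j<i) = ℕₚ.<-asym i<j j<i

parity-inversions-transpose-< : ∀ {n} (σ : Permutation′ n) {i j : Fin n} → i Fin.< j →
  parity (inversions (transpose i j ∘ₚ σ)) ≡ parity (inversions σ) ⁻¹
parity-inversions-transpose-< σ {i} {j} i<j
  with tabulate-transpose f i<j (λ z → z ≢ f i × z ≢ f j)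
         (λ k k≢i k≢j → (k≢i ∘ f-injective) , (k≢j ∘ f-injective))
  where
  f : Fin _ → ℕ
  f = toℕ ∘ (σ ⟨$⟩ʳ_)
  f-injective : ∀ {k l} → f k ≡ f l → k ≡ l
  f-injective = ⟨$⟩ʳ-injective σ ∘ Finₚ.toℕ-injective
... | P , M , S , σ≡ , τσ≡ , M∌ = begin
  parity (inversions (transpose i j ∘ₚ σ))
    ≡⟨ cong parity (trans (inversions≡listInversions (transpose i j ∘ₚ σ)) (cong listInversions τσ≡)) ⟩
  parity (listInversions (P ++ y ∷ M ++ x ∷ S))
    ≡⟨ listInversions-swap P x y M S x≢y M∌ ⟩
  parity (listInversions (P ++ x ∷ M ++ y ∷ S)) ⁻¹
    ≡⟨ cong (λ m → parity m ⁻¹) (trans (inversions≡listInversions σ) (cong listInversions σ≡)) ⟨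
  parity (inversions σ) ⁻¹ ∎
  where
  open ≡-Reasoning
  x y : ℕ
  x = toℕ (σ ⟨$⟩ʳ i)
  y = toℕ (σ ⟨$⟩ʳ j)
  x≢y : x ≢ y
  x≢y eq = ℕₚ.<⇒≢ i<j (cong toℕ (⟨$⟩ʳ-injective σ (Finₚ.toℕ-injective eq)))

parity-inversions-transpose : ∀ {n} (σ : Permutation′ n) {i j : Fin n} → i ≢ j →
  parity (inversions (transpose i j ∘ₚ σ)) ≡ parity (inversions σ) ⁻¹
parity-inversions-transpose σ {i} {j} i≢j with Finₚ.<-cmp i j
... | tri< i<j _ _ = parity-inversions-transpose-< σ i<j
... | tri≈ _ i≡j _ = ⊥-elim (i≢j i≡j)
... | tri> _ _ j<i = trans
  (cong parity (inversions-cong {π = transpose i j ∘ₚ σ} {transpose j i ∘ₚ σ}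
                                (λ k → cong (σ ⟨$⟩ʳ_) (transpose-comm i j k))))
  (parity-inversions-transpose-< σ j<i)

Proper : ∀ {n} → Fin n × Fin n → Set
Proper (i , j) = i ≢ j

parity-inversions-eval : ∀ {n} (xs : TranspositionList n) → All Proper xs →
  parity (inversions (eval xs)) ≡ parity (length xs)
parity-inversions-eval {n} []     []               = cong parity (inversions-id {n})
parity-inversions-eval ((i , j) ∷ xs) (i≢j ∷ xs-proper) = begin
  parity (inversions (transpose i j ∘ₚ eval xs)) ≡⟨ parity-inversions-transpose (eval xs) i≢j ⟩
  parity (inversions (eval xs)) ⁻¹               ≡⟨ cong _⁻¹ (parity-inversions-eval xs xs-proper) ⟩
  parity (length xs) ⁻¹                          ≡⟨ parity-suc (length xs) ⟨
  parity (suc (length xs))                       ∎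
  where open ≡-Reasoning

eval-even : ∀ {n} (xs : TranspositionList n) → All Proper xs → parity (length xs) ≡ 0ℙ →
  IsEvenPerm (eval xs)
eval-even xs xs-proper even-length =
  parity≡0ℙ⇒Even _ (trans (parity-inversions-eval xs xs-proper) even-length)

eval-++ : ∀ {n} (xs ys : TranspositionList n) z → eval (xs ++ ys) ⟨$⟩ʳ z ≡ eval ys ⟨$⟩ʳ (eval xs ⟨$⟩ʳ z)
eval-++ []             ys z = refl
eval-++ ((i , j) ∷ xs) ys z = eval-++ xs ys (PC.transpose i j z)

-- Maps between finite sets

funToFin-cong : ∀ {m n} (f g : Fin m → Fin n) → (∀ i → f i ≡ g i) → funToFin f ≡ funToFin g
funToFin-cong {zero}  f g f≗g = refl
funToFin-cong {suc m} f g f≗g = cong₂ Fin.combine (f≗g zero) (funToFin-cong (f ∘ suc) (g ∘ suc) (f≗g ∘ suc))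

funToFin-injective : ∀ {m n} (f g : Fin m → Fin n) → funToFin f ≡ funToFin g → ∀ i → f i ≡ g i
funToFin-injective f g eq i =
  trans (sym (Finₚ.finToFun-funToFin f i)) (trans (cong (λ w → finToFun w i) eq) (Finₚ.finToFun-funToFin g i))

≗-punchIn : ∀ {m} {A : Set} (i : Fin (suc m)) (f g : Fin (suc m) → A) →
  f i ≡ g i → (∀ j → f (punchIn i j) ≡ g (punchIn i j)) → ∀ l → f l ≡ g l
≗-punchIn i f g fi≡gi f≗g l with i Fin.≟ l
... | yes refl = fi≡gi
... | no  i≢l  = subst (λ l′ → f l′ ≡ g l′) (Finₚ.punchIn-punchOut i≢l) (f≗g (punchOut i≢l))

injective⇒surjective : ∀ {m m′} (f : Fin m → Fin m′) → Injective _≡_ _≡_ f → m′ ≤ m →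
  ∀ w → ∃ λ x → f x ≡ w
injective⇒surjective {m′ = suc m′} f f-inj m′≤m w with Finₚ.any? (λ x → f x Fin.≟ w)
... | yes hit = hit
... | no  miss = ⊥-elim (ℕₚ.<-irrefl refl (ℕₚ.<-≤-trans (s≤s (Finₚ.injective⇒≤ f′-inj)) m′≤m))
  where
  f≢w : ∀ x → w ≢ f x
  f≢w x w≡fx = miss (x , sym w≡fx)
  f′-inj : Injective _≡_ _≡_ (λ x → punchOut (f≢w x))
  f′-inj eq = f-inj (Finₚ.punchOut-injective (f≢w _) (f≢w _) eq)

surjective∧collision⇒< : ∀ {m m′} (f : Fin m → Fin m′) → (∀ w → ∃ λ x → f x ≡ w) →
  ∀ {x y} → x ≢ y → f x ≡ f y → m′ < m
surjective∧collision⇒< {suc m} {m′} f f-surj {x} {y} x≢y fx≡fy = s≤s (Finₚ.injective⇒≤ section-inj)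
  where
  avoid-y : ∀ w → ∃ λ z → z ≢ y × f z ≡ w
  avoid-y w with f-surj w
  ... | z , fz≡w with z Fin.≟ y
  ...   | yes refl = x , x≢y , trans fx≡fy fz≡w
  ...   | no  z≢y  = z , z≢y , fz≡w
  preimage : Fin m′ → Fin (suc m)
  preimage w = proj₁ (avoid-y w)
  y≢preimage : ∀ w → y ≢ preimage w
  y≢preimage w = proj₁ (proj₂ (avoid-y w)) ∘ sym
  section-inj : Injective _≡_ _≡_ (λ w → punchOut (y≢preimage w))
  section-inj {w} {w′} eq =
    trans (sym (proj₂ (proj₂ (avoid-y w))))
      (trans (cong f (Finₚ.punchOut-injective (y≢preimage w) (y≢preimage w′) eq)) (proj₂ (proj₂ (avoid-y w′))))

lookup-injective : ∀ {A : Set} {xs : List A} → Unique xs → Injective _≡_ _≡_ (lookup xs)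
lookup-injective (_     ∷ _)  {zero}  {zero}  _  = refl
lookup-injective (x∉xs ∷ _)  {zero}  {suc j} eq = ⊥-elim (All.lookup x∉xs (∈-lookup j) eq)
lookup-injective (x∉xs ∷ _)  {suc i} {zero}  eq = ⊥-elim (All.lookup x∉xs (∈-lookup i) (sym eq))
lookup-injective (_     ∷ xs!) {suc i} {suc j} eq = cong suc (lookup-injective xs! eq)

-- Signatures of points with respect to a family of partitions

enumerate-block : ∀ {n a b} (P : Partition n a b) (v : Fin b) →
  ∃ λ (e : Fin a → Fin n) → (∀ p → block P (e p) ≡ v) × Injective _≡_ _≡_ e
enumerate-block {n} P v = e , in-block , e-inj
  where
  members : List (Fin n)
  members = filter (λ z → block P z Fin.≟ v) (allFin n)
  members! : Unique members
  members! = Uniqueₚ.filter⁺ (λ z → block P z Fin.≟ v) (Uniqueₚ.allFin⁺ n)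
  e : Fin _ → Fin n
  e p = lookup members (Fin.cast (sym (sizes P v)) p)
  in-block : ∀ p → block P (e p) ≡ v
  in-block p = proj₂ (∈-filter⁻ (λ z → block P z Fin.≟ v) {xs = allFin n} (∈-lookup {xs = members} _))
  e-inj : Injective _≡_ _≡_ e
  e-inj {p} {q} eq = begin
    p                                              ≡⟨ Finₚ.cast-involutive (sizes P v) (sym (sizes P v)) p ⟨
    Fin.cast (sizes P v) (Fin.cast (sym (sizes P v)) p) ≡⟨ cong (Fin.cast (sizes P v)) (lookup-injective members! eq) ⟩
    Fin.cast (sizes P v) (Fin.cast (sym (sizes P v)) q) ≡⟨ Finₚ.cast-involutive (sizes P v) (sym (sizes P v)) q ⟩
    q                                              ∎
    where open ≡-Reasoning

fixes-relabelling : ∀ {n a b} (g : Permutation′ n) (P : Partition n a b) (ρ : Fin b → Fin b) →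
  Injective _≡_ _≡_ ρ → (∀ z → block P (g ⟨$⟩ʳ z) ≡ ρ (block P z)) → Fixes g P
fixes-relabelling g P ρ ρ-inj relabel x y = mk⇔
  (λ eq → ρ-inj (trans (sym (relabel x)) (trans eq (relabel y))))
  (λ eq → trans (relabel x) (trans (cong ρ eq) (sym (relabel y))))

signature : ∀ {n a b k} → (Fin k → Partition n a b) → Fin n → Fin (b ^ k)
signature Ps z = funToFin (λ i → block (Ps i) z)

signature-≡ : ∀ {n a b k} (Ps : Fin k → Partition n a b) {x y} →
  signature Ps x ≡ signature Ps y → ∀ i → block (Ps i) x ≡ block (Ps i) y
signature-≡ Ps = funToFin-injective _ _

transpose-preserves-blocks : ∀ {n a b k} (Ps : Fin k → Partition n a b) {x y} →
  signature Ps x ≡ signature Ps y → ∀ i z → block (Ps i) (PC.transpose x y z) ≡ block (Ps i) z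
transpose-preserves-blocks Ps x~y i z = transpose-elim (λ w → block (Ps i) w ≡ block (Ps i) z) z
  (λ { refl → sym (signature-≡ Ps x~y i) })
  (λ { refl → signature-≡ Ps x~y i })
  (λ _ _ → refl)

collisions-coincide : ∀ {a b k} (Ps : Fin k → Partition (a * b) a b) → IsBase a b k Ps →
  ∀ {x y p q} → x ≢ y → signature Ps x ≡ signature Ps y →
  p ≢ q → signature Ps p ≡ signature Ps q → (p ≡ x × q ≡ y) ⊎ (p ≡ y × q ≡ x)
collisions-coincide {a} {b} Ps base {x} {y} {p} {q} x≢y x~y p≢q p~q =
  transpose-elim (λ t → t ≡ y → (p ≡ x × q ≡ y) ⊎ (p ≡ y × q ≡ x)) x
    (λ x≡p q≡y → inj₁ (sym x≡p , q≡y))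
    (λ x≡q p≡y → inj₂ (p≡y , sym x≡q))
    (λ _ _ → ⊥-elim ∘ x≢y)
    (trans (cong (PC.transpose p q) (sym (transpose-matchʳ x y))) (g-fixes y))
  where
  xs : TranspositionList (a * b)
  xs = (x , y) ∷ (p , q) ∷ []
  g-fixes : ∀ z → eval xs ⟨$⟩ʳ z ≡ z
  g-fixes = base (eval xs) (eval-even xs (x≢y ∷ p≢q ∷ []) refl)
    (λ i → fixes-relabelling (eval xs) (Ps i) (λ t → t) (λ eq → eq)
      (λ z → trans (transpose-preserves-blocks Ps p~q i _) (transpose-preserves-blocks Ps x~y i z)))

Injective₂ : ∀ {A B C : Set} → (A → B → C) → Set
Injective₂ E = ∀ {t r t′ r′} → E t r ≡ E t′ r′ → t ≡ t′ × r ≡ r′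

columnSwaps : ∀ {b c n} → (Fin b → Fin c → Fin n) → Fin b → Fin b → TranspositionList n
columnSwaps E u v = tabulate (λ r → E u r , E v r)

length-columnSwaps : ∀ {b c n} (E : Fin b → Fin c → Fin n) u v → length (columnSwaps E u v) ≡ c
length-columnSwaps E u v = Listₚ.length-tabulate (λ r → E u r , E v r)

columnSwaps-proper : ∀ {b c n} (E : Fin b → Fin c → Fin n) → Injective₂ E →
  ∀ {u v} → u ≢ v → All Proper (columnSwaps E u v)
columnSwaps-proper E E-inj u≢v = Allₚ.tabulate⁺ (λ r eq → u≢v (proj₁ (E-inj eq)))

columnSwaps-outside : ∀ {b c n} (E : Fin b → Fin c → Fin n) u v {z} →
  (∀ t r → E t r ≢ z) → eval (columnSwaps E u v) ⟨$⟩ʳ z ≡ z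
columnSwaps-outside {c = zero}  E u v z∉E = refl
columnSwaps-outside {c = suc c} E u v z∉E =
  trans (cong (eval (columnSwaps (λ t r → E t (suc r)) u v) ⟨$⟩ʳ_)
              (transpose-other (z∉E u zero ∘ sym) (z∉E v zero ∘ sym)))
        (columnSwaps-outside (λ t r → E t (suc r)) u v (λ t r → z∉E t (suc r)))

columnSwaps-action : ∀ {b c n} (E : Fin b → Fin c → Fin n) → Injective₂ E →
  ∀ u v t r → eval (columnSwaps E u v) ⟨$⟩ʳ E t r ≡ E (PC.transpose u v t) r
columnSwaps-action {c = suc c} E E-inj u v t zero =
  trans (cong (eval (columnSwaps E′ u v) ⟨$⟩ʳ_) (transpose-natural (proj₁ ∘ E-inj) u v t))
        (columnSwaps-outside E′ u v (λ t′ r′ → later-column t′ r′ _))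
  where
  E′ : _ → Fin c → _
  E′ t r = E t (suc r)
  later-column : ∀ t r s → E t (suc r) ≢ E s zero
  later-column t r s eq with () ← proj₂ (E-inj eq)
columnSwaps-action {c = suc c} E E-inj u v t (suc r) =
  trans (cong (eval (columnSwaps E′ u v) ⟨$⟩ʳ_) (transpose-other (later-column u) (later-column v)))
        (columnSwaps-action E′ (map₂ Finₚ.suc-injective ∘ E-inj) u v t r)
  where
  E′ : _ → Fin c → _
  E′ t r = E t (suc r)
  later-column : ∀ s → E t (suc r) ≢ E s zero
  later-column s eq with () ← proj₂ (E-inj eq)

module Grid {a b k′ : ℕ} (Ps : Fin (suc k′) → Partition (a * b) a b) (base : IsBase a b (suc k′) Ps)
  (signature-injective : Injective _≡_ _≡_ (signature Ps)) (small : b ^ k′ ≤ a) where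

  signature-surjective : ∀ w → ∃ λ z → signature Ps z ≡ w
  signature-surjective = injective⇒surjective (signature Ps) signature-injective
    (ℕₚ.≤-trans (ℕₚ.*-monoʳ-≤ b small) (ℕₚ.≤-reflexive (ℕₚ.*-comm b a)))

  point : Fin b → Fin (b ^ k′) → Fin (a * b)
  point t r = proj₁ (signature-surjective (Fin.combine t r))

  point-signature : ∀ t r → signature Ps (point t r) ≡ Fin.combine t r
  point-signature t r = proj₂ (signature-surjective (Fin.combine t r))

  point-coordinates : ∀ t r → block (Ps zero) (point t r) ≡ t × signature (Ps ∘ suc) (point t r) ≡ r
  point-coordinates t r = Finₚ.combine-injective _ _ t r (point-signature t r)

  point-injective : Injective₂ point
  point-injective {t} {r} {t′} {r′} eq = Finₚ.combine-injective t r t′ r′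
    (trans (sym (point-signature t r)) (trans (cong (signature Ps) eq) (point-signature t′ r′)))

  point-covers : ∀ z → point (block (Ps zero) z) (signature (Ps ∘ suc) z) ≡ z
  point-covers z = signature-injective (point-signature _ _)

  relabelling-fixes : ∀ (g : Permutation′ (a * b)) (ρ : Fin b → Fin b) → Injective _≡_ _≡_ ρ →
    (∀ t r → g ⟨$⟩ʳ point t r ≡ point (ρ t) r) → ∀ i → Fixes g (Ps i)
  relabelling-fixes g ρ ρ-inj g-acts = fixes
    where
    g-moves : ∀ z → g ⟨$⟩ʳ z ≡ point (ρ (block (Ps zero) z)) (signature (Ps ∘ suc) z)
    g-moves z = trans (cong (g ⟨$⟩ʳ_) (sym (point-covers z))) (g-acts _ _)
    fixes : ∀ i → Fixes g (Ps i)
    fixes zero    = fixes-relabelling g (Ps zero) ρ ρ-inj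
      (λ z → trans (cong (block (Ps zero)) (g-moves z)) (proj₁ (point-coordinates _ _)))
    fixes (suc j) = fixes-relabelling g (Ps (suc j)) (λ t → t) (λ eq → eq)
      (λ z → signature-≡ (Ps ∘ suc)
               (trans (cong (signature (Ps ∘ suc)) (g-moves z)) (proj₂ (point-coordinates _ _))) j)

  relabelling-impossible : ∀ (ρ : Fin b → Fin b) → Injective _≡_ _≡_ ρ → ∀ {u} → ρ u ≢ u →
    (xs : TranspositionList (a * b)) → All Proper xs → parity (length xs) ≡ 0ℙ →
    (∀ t r → eval xs ⟨$⟩ʳ point t r ≡ point (ρ t) r) → ⊥
  relabelling-impossible ρ ρ-inj {u} ρu≢u xs xs-proper even xs-acts =
    ρu≢u (proj₁ (point-injective (trans (sym (xs-acts u r)) (g-fixes (point u r)))))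
    where
    r : Fin (b ^ k′)
    r = funToFin {k′} (λ _ → u)
    g-fixes : ∀ z → eval xs ⟨$⟩ʳ z ≡ z
    g-fixes = base (eval xs) (eval-even xs xs-proper even) (relabelling-fixes (eval xs) ρ ρ-inj xs-acts)

-- For b = 2 the two rows are swapped in each of the 2^k′ columns, an even number
-- because injectivity gives 2 ≤ a ≤ 2^k′.  For b ≥ 3 three rows are cycled,
-- which takes two transpositions per column.
injective-signature-impossible : ∀ {a b′ k′} (Ps : Fin (suc k′) → Partition (a * 2+ b′) a (2+ b′)) →
  IsBase a (2+ b′) (suc k′) Ps → 2 ≤ a → (2+ b′) ^ k′ ≤ a → ¬ Injective _≡_ _≡_ (signature Ps)
injective-signature-impossible {a} {zero} {zero} Ps base 2≤a small inj =
  ℕₚ.<-irrefl refl (ℕₚ.<-≤-trans 2≤a (ℕₚ.*-cancelʳ-≤ a 1 2 (Finₚ.injective⇒≤ inj)))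
injective-signature-impossible {a} {zero} {suc k″} Ps base 2≤a small inj =
  relabelling-impossible (PC.transpose zero one) (transpose-injective zero one) {zero} (λ ())
    swaps (columnSwaps-proper point point-injective {zero} {one} λ ())
    (trans (cong parity (length-columnSwaps point zero one)) (Parityₚ.*-homo-* 2 (2 ^ k″)))
    (columnSwaps-action point point-injective zero one)
  where
  open Grid Ps base inj small
  one : Fin 2
  one = suc zero
  swaps : TranspositionList (a * 2)
  swaps = columnSwaps point zero one
injective-signature-impossible {a} {suc b″} {k′} Ps base 2≤a small inj =
  relabelling-impossible (PC.transpose one two ∘ PC.transpose zero one)
    (transpose-injective zero one ∘ transpose-injective one two) {zero} (λ ())
    (swaps₀₁ ++ swaps₁₂)
    (Allₚ.++⁺ (columnSwaps-proper point point-injective {zero} {one} λ ())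
              (columnSwaps-proper point point-injective {one} {two} λ ()))
    even-length cycle
  where
  open Grid Ps base inj small
  open ≡-Reasoning
  one two : Fin (2+ (suc b″))
  one = suc zero
  two = suc (suc zero)
  swaps₀₁ swaps₁₂ : TranspositionList (a * 2+ (suc b″))
  swaps₀₁ = columnSwaps point zero one
  swaps₁₂ = columnSwaps point one two
  even-length : parity (length (swaps₀₁ ++ swaps₁₂)) ≡ 0ℙ
  even-length = begin
    parity (length (swaps₀₁ ++ swaps₁₂))      ≡⟨ cong parity (Listₚ.length-++ swaps₀₁) ⟩
    parity (length swaps₀₁ + length swaps₁₂)  ≡⟨ cong parity (cong₂ _+_ (length-columnSwaps point zero one)
                                                                        (length-columnSwaps point one two)) ⟩
    parity (2+ (suc b″) ^ k′ + 2+ (suc b″) ^ k′) ≡⟨ parity-double (2+ (suc b″) ^ k′) ⟩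
    0ℙ                                        ∎
  cycle : ∀ t r →
    eval (swaps₀₁ ++ swaps₁₂) ⟨$⟩ʳ point t r ≡ point (PC.transpose one two (PC.transpose zero one t)) r
  cycle t r = begin
    eval (swaps₀₁ ++ swaps₁₂) ⟨$⟩ʳ point t r
      ≡⟨ eval-++ swaps₀₁ swaps₁₂ (point t r) ⟩
    eval swaps₁₂ ⟨$⟩ʳ (eval swaps₀₁ ⟨$⟩ʳ point t r)
      ≡⟨ cong (eval swaps₁₂ ⟨$⟩ʳ_) (columnSwaps-action point point-injective zero one t r) ⟩
    eval swaps₁₂ ⟨$⟩ʳ point (PC.transpose zero one t) r
      ≡⟨ columnSwaps-action point point-injective one two (PC.transpose zero one t) r ⟩
    point (PC.transpose one two (PC.transpose zero one t)) r ∎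

module Collision {a b′ k′ : ℕ} (Ps : Fin (suc k′) → Partition (a * 2+ b′) a (2+ b′))
  (base : IsBase a (2+ b′) (suc k′) Ps) (small : (2+ b′) ^ k′ ≤ a)
  {x y : Fin (a * 2+ b′)} (x≢y : x ≢ y) (x~y : signature Ps x ≡ signature Ps y) where

  module Block (i : Fin (suc k′)) {v : Fin (2+ b′)} (v≢x : v ≢ block (Ps i) x) where

    member : Fin a → Fin (a * 2+ b′)
    member = proj₁ (enumerate-block (Ps i) v)

    member-in-block : ∀ p → block (Ps i) (member p) ≡ v
    member-in-block = proj₁ (proj₂ (enumerate-block (Ps i) v))

    others : Fin a → Fin ((2+ b′) ^ k′)
    others p = signature (Ps ∘ punchIn i) (member p)

    member-injective : Injective _≡_ _≡_ member
    member-injective = proj₂ (proj₂ (enumerate-block (Ps i) v))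

    others-injective : Injective _≡_ _≡_ others
    others-injective {p} {q} eq with member p Fin.≟ member q
    ... | yes p≡q = member-injective p≡q
    ... | no  p≢q with collisions-coincide Ps base x≢y x~y p≢q member-collision
      where
      member-collision : signature Ps (member p) ≡ signature Ps (member q)
      member-collision = funToFin-cong blocks-p blocks-q
        (≗-punchIn i blocks-p blocks-q (trans (member-in-block p) (sym (member-in-block q)))
                                       (signature-≡ (Ps ∘ punchIn i) eq))
        where
        blocks-p blocks-q : Fin (suc k′) → Fin (2+ b′)
        blocks-p l = block (Ps l) (member p)
        blocks-q l = block (Ps l) (member q)
    ...   | inj₁ (p≡x , _) = ⊥-elim (v≢x (trans (sym (member-in-block p)) (cong (block (Ps i)) p≡x)))
    ...   | inj₂ (p≡y , _) = ⊥-elim (v≢x (trans (sym (member-in-block p))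
                                         (trans (cong (block (Ps i)) p≡y) (sym (signature-≡ Ps x~y i)))))

    others-surjective : ∀ r → ∃ λ p → others p ≡ r
    others-surjective = injective⇒surjective others others-injective small

  a≤bᵏ′ : a ≤ (2+ b′) ^ k′
  a≤bᵏ′ = Finₚ.injective⇒≤ (Block.others-injective zero (Finₚ.punchInᵢ≢i (block (Ps zero) x) zero))

  signature-surjective : ∀ w → ∃ λ z → signature Ps z ≡ w
  signature-surjective w with Finₚ.any? (λ i → ¬? (finToFun w i Fin.≟ block (Ps i) x))
  ... | yes (i , wᵢ≢x) = member p , (begin
    signature Ps (member p)
      ≡⟨ funToFin-cong blocks (finToFun w) (≗-punchIn i blocks (finToFun w) (member-in-block p)
                                                       (funToFin-injective _ _ p-fits)) ⟩
    funToFin (finToFun {2+ b′} {suc k′} w)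
      ≡⟨ Finₚ.funToFin-finToFin {suc k′} {2+ b′} w ⟩
    w                        ∎)
    where
    open ≡-Reasoning
    open Block i wᵢ≢x
    p : Fin a
    p = proj₁ (others-surjective (funToFin (finToFun w ∘ punchIn i)))
    p-fits : others p ≡ funToFin (finToFun w ∘ punchIn i)
    p-fits = proj₂ (others-surjective (funToFin (finToFun w ∘ punchIn i)))
    blocks : Fin (suc k′) → Fin (2+ b′)
    blocks l = block (Ps l) (member p)
  ... | no  w-agrees =
    x , trans (funToFin-cong (λ i → block (Ps i) x) (finToFun w) x≗w) (Finₚ.funToFin-finToFin {suc k′} {2+ b′} w)
    where
    x≗w : ∀ i → block (Ps i) x ≡ finToFun w i
    x≗w i with finToFun w i Fin.≟ block (Ps i) x
    ... | yes wᵢ≡x = sym wᵢ≡x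
    ... | no  wᵢ≢x = ⊥-elim (w-agrees (i , wᵢ≢x))

  impossible : ⊥
  impossible = ℕₚ.<⇒≱ (surjective∧collision⇒< (signature Ps) signature-surjective x≢y x~y)
    (ℕₚ.≤-trans (ℕₚ.≤-reflexive (ℕₚ.*-comm a (2+ b′))) (ℕₚ.*-monoʳ-≤ (2+ b′) a≤bᵏ′))

-- Bounding the size of a base

m<n+1⇒m≤n : ∀ {m} n → m < n + 1 → m ≤ n
m<n+1⇒m≤n {m} n = ℕₚ.m<1+n⇒m≤n ∘ subst (m <_) (ℕₚ.+-comm n 1)

ceilLogFrom-minimal : ∀ b x m fuel {j} → m ≤ j → j < ceilLogFrom b x m fuel → b ^ j < x
ceilLogFrom-minimal b x m zero       m≤j j<m = ⊥-elim (ℕₚ.≤⇒≯ m≤j j<m)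
ceilLogFrom-minimal b x m (suc fuel) {j} m≤j j<log with x ℕ.≤? b ^ m
... | yes _    = ⊥-elim (ℕₚ.≤⇒≯ m≤j j<log)
... | no x≰bᵐ with m ℕ.≟ j
...   | yes refl = ℕₚ.≰⇒> x≰bᵐ
...   | no  m≢j  = ceilLogFrom-minimal b x (suc m) fuel (ℕₚ.≤∧≢⇒< m≤j m≢j) j<log

ceilLog-minimal : ∀ b x {j} → j < ceilLog b x → b ^ j < x
ceilLog-minimal b x = ceilLogFrom-minimal b x 0 x z≤n

empty-family-not-base : ∀ {a′ b′} (Ps : Fin 0 → Partition (2+ a′ * 2+ b′) (2+ a′) (2+ b′)) →
  ¬ IsBase (2+ a′) (2+ b′) 0 Ps
empty-family-not-base {a′} {b′} Ps base = distinct-points (collisions-coincide Ps base x≢y refl x≢q refl)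
  where
  2<ab : 2 < 2+ a′ * 2+ b′
  2<ab = ℕₚ.≤-trans (ℕₚ.n≤1+n 3) (ℕₚ.*-mono-≤ (s≤s (s≤s (z≤n {a′}))) (s≤s (s≤s (z≤n {b′}))))
  x y q : Fin (2+ a′ * 2+ b′)
  x = zero
  y = suc zero
  q = Fin.fromℕ< 2<ab
  toℕ-q : toℕ q ≡ 2
  toℕ-q = Finₚ.toℕ-fromℕ< 2<ab
  x≢y : x ≢ y
  x≢y ()
  x≢q : x ≢ q
  x≢q eq with () ← trans (cong toℕ eq) toℕ-q
  distinct-points : ¬ ((x ≡ x × q ≡ y) ⊎ (x ≡ y × q ≡ x))
  distinct-points (inj₁ (_ , q≡y)) with () ← trans (sym toℕ-q) (cong toℕ q≡y)
  distinct-points (inj₂ (() , _))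

small-family-not-base : ∀ {a b′ k′} (Ps : Fin (suc k′) → Partition (a * 2+ b′) a (2+ b′)) →
  IsBase a (2+ b′) (suc k′) Ps → 2 ≤ a → (2+ b′) ^ k′ ≤ a → ⊥
small-family-not-base Ps base 2≤a small
  with Finₚ.any? (λ x → Finₚ.any? (λ y → ¬? (x Fin.≟ y) ×-dec (signature Ps x Fin.≟ signature Ps y)))
... | yes (x , y , x≢y , x~y) = Collision.impossible Ps base small x≢y x~y
... | no  no-collision = injective-signature-impossible Ps base 2≤a small injective
  where
  injective : Injective _≡_ _≡_ (signature Ps)
  injective {x} {y} x~y with x Fin.≟ y
  ... | yes x≡y = x≡y
  ... | no  x≢y = ⊥-elim (no-collision (x , y , x≢y , x~y))

lemma3p2 : ∀ (a b : ℕ) → 2 ≤ a → 2 ≤ b → Faithful a b →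
    ∀ (k : ℕ) (Ps : Fin k → Partition (a * b) a b) → IsBase a b k Ps →
    ceilLog b (a + 1) + 1 ≤ k
-- The bound holds for every base.
lemma3p2 (2+ a′) (2+ b′) 2≤a _ _ zero     Ps base = ⊥-elim (empty-family-not-base Ps base)
lemma3p2 (2+ a′) (2+ b′) 2≤a _ _ (suc k′) Ps base with ceilLog (2+ b′) (2+ a′ + 1) + 1 ℕ.≤? suc k′
... | yes enough = enough
... | no  too-few = ⊥-elim (small-family-not-base Ps base 2≤a
  (m<n+1⇒m≤n (2+ a′) (ceilLog-minimal (2+ b′) (2+ a′ + 1)
    (m<n+1⇒m≤n (ceilLog (2+ b′) (2+ a′ + 1)) (ℕₚ.≰⇒> too-few)))))
lemma3p2 zero       _          ()          _           _ _ _ _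
lemma3p2 (suc zero) _          (s≤s ())    _           _ _ _ _
lemma3p2 (2+ _)     zero       _           ()          _ _ _ _
lemma3p2 (2+ _)     (suc zero) _           (s≤s ())    _ _ _ _
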